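{- Let $P$ be a normal logic program with exactly $n\ge 2$ clauses such that $P$ has $s(n)$ stable models (i.e. $P$ is extremal). Then: (1) no redundant atom of $P$ occurs positively in the body of a clause of $P$; (2) $P$ contains no redundant clause; (3) $P$ contains no clause with empty body; (4) for every clause $r$ of $P$, the head of $r$ occurs (positively or negated) in the body of some clause of $P$ other than $r$.
   Context: A (normal) logic program is a finite set of clauses $a\leftarrow b_1,\ldots,b_m,\mathbf{not}(c_1),\ldots,\mathbf{not}(c_k)$ with atoms $a,b_i,c_j$. For a set of atoms $M$, the reduct $P^M$ is obtained by deleting every clause whose body contains $\mathbf{not}(c)$ with $c\in M$ and deleting all negative literals from the remaining clauses; $M$ is a stable model of $P$ if $M$ is the least model of $P^M$. $s(n)$ is the maximum number of stable models of a logic program with at most $n$ clauses. An atom occurring in $P$ is redundant if it is not the head of any clause of $P$. A clause is redundant if its head occurs (positively or negated) in its own body, or if some atom $q$ occurs both as $q$ and as $\mathbf{not}(q)$ in its body. -}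

module Defs where

open import Data.Nat using (ℕ; _≤_)
open import Data.List using (List; []; length; lookup)
open import Data.List.Membership.Propositional using (_∈_)
open import Data.List.Relation.Unary.All using (All)
open import Data.List.Relation.Unary.Any using (Any)
open import Data.List.Relation.Unary.AllPairs using (AllPairs)
open import Data.Fin using (Fin)
open import Data.Product using (Σ; _×_; ∃)
open import Data.Sum using (_⊎_)
open import Relation.Nullary using (¬_)
open import Relation.Binary.PropositionalEquality using (_≡_; _≢_)

Atom : Set
Atom = ℕ

-- A clause  head ← pos₁,…,posₘ, not(neg₁),…,not(negₖ)
record Clause : Set where
  constructor _⇐_∣_
  field
    head : Atom
    pos  : List Atom
    neg  : List Atom
open Clause public

Program : Set
Program = List Clause

-- Finite sets of atoms, represented by lists (up to set equality).
AtomSet : Set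
AtomSet = List Atom

_⊆_ : AtomSet → AtomSet → Set
A ⊆ B = ∀ {x} → x ∈ A → x ∈ B

_≐_ : AtomSet → AtomSet → Set
A ≐ B = (A ⊆ B) × (B ⊆ A)

-- Two clauses are the same clause (bodies are sets of literals).
SameClause : Clause → Clause → Set
SameClause c d = (head c ≡ head d) × (pos c ≐ pos d) × (neg c ≐ neg d)

-- P has pairwise distinct clauses (so P has exactly length P clauses).
DistinctClauses : Program → Set
DistinctClauses P = AllPairs (λ c d → ¬ SameClause c d) P

-- Body of c survives in the reduct P^M: no negated atom of c lies in M.
Survives : AtomSet → Clause → Set
Survives M c = All (λ a → ¬ (a ∈ M)) (neg c)

ModelOfReduct : Program → AtomSet → AtomSet → Set
ModelOfReduct P M N =
  All (λ c → Survives M c → pos c ⊆ N → head c ∈ N) P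

StableModel : Program → AtomSet → Set
StableModel P M =
  ModelOfReduct P M M × (∀ N → ModelOfReduct P M N → M ⊆ N)

NumStableModels : Program → ℕ → Set
NumStableModels P k =
  Σ (List AtomSet) λ L →
    (length L ≡ k) ×
    All (StableModel P) L ×
    AllPairs (λ A B → ¬ (A ≐ B)) L ×
    (∀ M → StableModel P M → Any (M ≐_) L)

-- P (with k stable models) attains s(n): every program with at most n
-- clauses has at most k stable models.
Extremal : ℕ → Program → ℕ → Set
Extremal n P k =
  ∀ (Q : Program) (k' : ℕ) → length Q ≤ n → NumStableModels Q k' → k' ≤ k

OccursIn : Atom → Program → Set
OccursIn a P = Any (λ c → (a ≡ head c) ⊎ (a ∈ pos c) ⊎ (a ∈ neg c)) P

IsHeadIn : Atom → Program → Set
IsHeadIn a P = Any (λ c → head c ≡ a) P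

RedundantAtom : Program → Atom → Set
RedundantAtom P a = OccursIn a P × ¬ IsHeadIn a P

RedundantClause : Clause → Set
RedundantClause c =
  (head c ∈ pos c) ⊎ (head c ∈ neg c) ⊎ ∃ (λ q → (q ∈ pos c) × (q ∈ neg c))

InBody : Atom → Clause → Set
InBody a c = (a ∈ pos c) ⊎ (a ∈ neg c)

{-# OPTIONS --safe #-}
module Submission where

-- Extremality enters through one construction: a program with fewer than n clauses and k ≥ 2
-- distinct stable models (all nonempty, as [] can only be the unique stable model) yields one with
-- n clauses and k + 1 stable models, by adding  x ← not h₁, …, not hₘ  for a fresh atom x and the
-- heads hᵢ, and  not x  to every old body.  So no program with fewer clauses has k stable models.
-- For (1) and (2) the offending clause is satisfied by every subset of every stable model, so it
-- can be deleted without losing a stable model.  For (3) and (4) let a be the head of the clause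
-- and simplify P under a := true; this drops the clause, and M ↦ M ∖ a maps the stable models
-- of P injectively to stable models of the result: in (3) since a lies in every stable model,
-- in (4) since a occurs in no body and hence does not affect the reduct.

open import Defs
open import Data.Bool using (true; false)
open import Data.Empty using (⊥; ⊥-elim)
open import Data.Fin using (Fin; zero; suc)
import Data.Fin.Properties as Fin
open import Data.List
  using (List; []; _∷_; [_]; _++_; length; lookup; map; filter; removeAt; deduplicate)
open import Data.List.Properties using (length-++-≤ˡ; length-map; length-removeAt′; filter-notAll)
open import Data.List.Extrema.Nat using (max; xs≤max)
open import Data.List.Membership.Propositional using (_∈_; _∉_)
open import Data.List.Membership.Propositional.Properties
  using (∈-filter⁺; ∈-filter⁻; ∈-map⁺; ∈-++⁺ˡ; ∈-++⁺ʳ; ∈-lookup)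
open import Data.List.Relation.Unary.All as All using (All; []; _∷_)
import Data.List.Relation.Unary.All.Properties as All
open import Data.List.Relation.Unary.Any as Any using (Any; here; there)
import Data.List.Relation.Unary.Any.Properties as Any
open import Data.List.Relation.Unary.AllPairs using (AllPairs; []; _∷_)
import Data.List.Relation.Unary.AllPairs.Properties as AllPairs
open import Data.List.Relation.Unary.Unique.DecSetoid.Properties using (deduplicate-!)
open import Data.Nat using (ℕ; suc; _≤_; _<_; _<?_; _≟_; z≤n; s≤s)
open import Data.Nat.Properties using (<-irrefl; <-≤-trans; ≤-reflexive; ≮⇒≥; <⇒≱)
open import Data.Product using (∃; _×_; _,_; proj₁; proj₂)
open import Data.Sum as Sum using (_⊎_; inj₁; inj₂)
open import Function using (_∘_; id)
open import Relation.Binary using (DecSetoid)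
open import Relation.Binary.PropositionalEquality using (_≡_; _≢_; refl; sym; cong; subst)
open import Relation.Nullary using (¬_; Dec; yes; no; ¬?; does)
open import Relation.Nullary.Decidable using (_×-dec_; _⊎-dec_; _→-dec_; map′)
open import Relation.Unary using (Decidable)
open import Data.List.Membership.DecPropositional _≟_ using (_∈?_)
open import Data.List.Relation.Binary.Subset.DecPropositional _≟_ using (_⊆?_)

≐-refl : ∀ {A} → A ≐ A
≐-refl = id , id

≐-sym : ∀ {A B} → A ≐ B → B ≐ A
≐-sym (A⊆B , B⊆A) = B⊆A , A⊆B

≐-trans : ∀ {A B C} → A ≐ B → B ≐ C → A ≐ C
≐-trans (A⊆B , B⊆A) (B⊆C , C⊆B) = B⊆C ∘ A⊆B , B⊆A ∘ C⊆B

_≐?_ : ∀ A B → Dec (A ≐ B)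
A ≐? B = A ⊆? B ×-dec B ⊆? A

≐-decSetoid : DecSetoid _ _
≐-decSetoid = record
  { Carrier          = AtomSet
  ; _≈_              = _≐_
  ; isDecEquivalence = record
    { isEquivalence = record { refl = ≐-refl ; sym = ≐-sym ; trans = ≐-trans }
    ; _≟_           = _≐?_
    }
  }

Distinct : List AtomSet → Set
Distinct = AllPairs (λ A B → ¬ A ≐ B)

infixl 30 _∩_ _∖_

_∩_ : AtomSet → AtomSet → AtomSet
A ∩ B = filter (_∈? B) A

∩-⊆ˡ : ∀ {A B} → A ∩ B ⊆ A
∩-⊆ˡ {A} {B} = proj₁ ∘ ∈-filter⁻ (_∈? B) {xs = A}

∩-⊆ʳ : ∀ {A B} → A ∩ B ⊆ B
∩-⊆ʳ {A} {B} = proj₂ ∘ ∈-filter⁻ (_∈? B) {xs = A}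

∈-∩⁺ : ∀ {x A B} → x ∈ A → x ∈ B → x ∈ A ∩ B
∈-∩⁺ {B = B} = ∈-filter⁺ (_∈? B)

_∖_ : AtomSet → Atom → AtomSet
A ∖ a = filter (λ x → ¬? (x ≟ a)) A

∈-∖⁺ : ∀ {x a A} → x ∈ A → x ≢ a → x ∈ A ∖ a
∈-∖⁺ {a = a} = ∈-filter⁺ (λ x → ¬? (x ≟ a))

∈-∖⁻ : ∀ {x a A} → x ∈ A ∖ a → x ∈ A × x ≢ a
∈-∖⁻ {a = a} {A} = ∈-filter⁻ (λ x → ¬? (x ≟ a)) {xs = A}

∖-⊆ : ∀ {a A} → A ∖ a ⊆ A
∖-⊆ = proj₁ ∘ ∈-∖⁻

⊆∷⇒∖⊆ : ∀ {a A B} → A ⊆ (a ∷ B) → A ∖ a ⊆ B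
⊆∷⇒∖⊆ A⊆a∷B x∈A∖a with ∈-∖⁻ x∈A∖a
... | x∈A , x≢a with A⊆a∷B x∈A
...   | here x≡a = ⊥-elim (x≢a x≡a)
...   | there x∈B = x∈B

∖-cancel : ∀ {a A B} → (a ∈ A → a ∈ B) → A ∖ a ⊆ B ∖ a → A ⊆ B
∖-cancel {a} a∈B A∖a⊆B∖a {x} x∈A with x ≟ a
... | yes refl = a∈B x∈A
... | no x≢a = ∖-⊆ (A∖a⊆B∖a (∈-∖⁺ x∈A x≢a))

sublists : ∀ {A : Set} → List A → List (List A)
sublists [] = [ [] ]
sublists (x ∷ xs) = map (x ∷_) (sublists xs) ++ sublists xs

filter∈sublists : ∀ {A : Set} {P : A → Set} (P? : Decidable P) xs → filter P? xs ∈ sublists xs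
filter∈sublists P? [] = here refl
filter∈sublists P? (x ∷ xs) with does (P? x)
... | true = ∈-++⁺ˡ (∈-map⁺ (x ∷_) (filter∈sublists P? xs))
... | false = ∈-++⁺ʳ _ (filter∈sublists P? xs)

SatisfiesReduct : AtomSet → AtomSet → Clause → Set
SatisfiesReduct M N c = Survives M c → pos c ⊆ N → head c ∈ N

heads : Program → AtomSet
heads = map head

survives-anti : ∀ {M M′ c} → M ⊆ M′ → Survives M′ c → Survives M c
survives-anti M⊆M′ = All.map (_∘ M⊆M′)

model-resp : ∀ {P M M′ N N′} → M ⊆ M′ → N ≐ N′ → ModelOfReduct P M N → ModelOfReduct P M′ N′
model-resp M⊆M′ (N⊆N′ , N′⊆N) =
  All.map λ {c} sat surv pos⊆N′ →
    N⊆N′ (sat (survives-anti {c = c} M⊆M′ surv) (λ q → N′⊆N (pos⊆N′ q)))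

stable-resp : ∀ {P M M′} → M ≐ M′ → StableModel P M → StableModel P M′
stable-resp M≐M′@(M⊆M′ , M′⊆M) (model , least) =
  model-resp M⊆M′ M≐M′ model , λ N modelN → least N (model-resp M′⊆M ≐-refl modelN) ∘ M′⊆M

model-∩ : ∀ {P M A B} → ModelOfReduct P M A → ModelOfReduct P M B → ModelOfReduct P M (A ∩ B)
model-∩ {A = A} {B} modelA modelB = All.zipWith
  (λ (satA , satB) surv pos⊆ →
    ∈-∩⁺ (satA surv (λ q → ∩-⊆ˡ {A} {B} (pos⊆ q))) (satB surv (λ q → ∩-⊆ʳ {A} (pos⊆ q))))
  (modelA , modelB)

heads-model : ∀ P M → ModelOfReduct P M (heads P)
heads-model P M = All.tabulate (λ c∈P _ _ → ∈-map⁺ head c∈P)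

stable⊆heads : ∀ {P M} → StableModel P M → M ⊆ heads P
stable⊆heads {P} {M} (_ , least) = least (heads P) (heads-model P M)

stable≐heads∩ : ∀ {P M} → StableModel P M → M ≐ heads P ∩ M
stable≐heads∩ {P} stM = (λ x∈M → ∈-∩⁺ (stable⊆heads stM x∈M) x∈M) , ∩-⊆ʳ {heads P}

stable? : ∀ P M → Dec (StableModel P M)
stable? P M = map′ fromSublists toSublists
  (modelOfReduct? M ×-dec All.all? (λ S → modelOfReduct? S →-dec M ⊆? S) (sublists M))
  where
  modelOfReduct? : ∀ N → Dec (ModelOfReduct P M N)
  modelOfReduct? N = All.all?
    (λ c → All.all? (λ a → ¬? (a ∈? M)) (neg c) →-dec (pos c ⊆? N →-dec head c ∈? N)) P
  ModelsBelow : Set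
  ModelsBelow = All (λ S → ModelOfReduct P M S → M ⊆ S) (sublists M)
  -- M ∩ N is again a model, and it is one of the sublists of M.
  fromSublists : ModelOfReduct P M M × ModelsBelow → StableModel P M
  fromSublists (model , least) = model , λ N modelN →
    ∩-⊆ʳ {M} ∘ All.lookup least (filter∈sublists (_∈? N) M) (model-∩ model modelN)
  toSublists : StableModel P M → ModelOfReduct P M M × ModelsBelow
  toSublists (model , least) = model , All.tabulate (λ {S} _ → least S)

-- Complete L by the stable sublists of the heads not yet in L, deduplicated up to ≐.
numStableModels-≥ : ∀ Q (L : List AtomSet) → All (StableModel Q) L → Distinct L →
  ∃ λ k → NumStableModels Q k × length L ≤ k
numStableModels-≥ Q L stL L! =
    length (L ++ new)
  , (L ++ new , refl , All.++⁺ stL (All.map proj₁ allNew) , AllPairs.++⁺ L! new! apart , complete)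
  , length-++-≤ˡ L
  where
  New : AtomSet → Set
  New S = StableModel Q S × ¬ Any (S ≐_) L
  new? : Decidable New
  new? S = stable? Q S ×-dec ¬? (Any.any? (S ≐?_) L)
  new : List AtomSet
  new = deduplicate _≐?_ (filter new? (sublists (heads Q)))
  allNew : All New new
  allNew = All.deduplicate⁺ _≐?_ (All.all-filter new? (sublists (heads Q)))
  new! : Distinct new
  new! = deduplicate-! ≐-decSetoid (filter new? (sublists (heads Q)))
  apart : All (λ A → All (λ B → ¬ A ≐ B) new) L
  apart = All.tabulate λ A∈L →
    All.map (λ (_ , B∉L) A≐B → B∉L (Any.map (λ { refl → ≐-sym A≐B }) A∈L)) allNew
  complete : ∀ M → StableModel Q M → Any (M ≐_) (L ++ new)
  complete M stM with Any.any? (heads Q ∩ M ≐?_) L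
  ... | yes S∈L = Any.++⁺ˡ (Any.map (≐-trans (stable≐heads∩ stM)) S∈L)
  ... | no S∉L = Any.++⁺ʳ L (Any.deduplicate⁺ _≐?_ (λ B≐A M≐A → ≐-trans M≐A (≐-sym B≐A))
      (Any.map (λ { refl → M≐S })
        (∈-filter⁺ new? (filter∈sublists (_∈? M) (heads Q)) (stable-resp M≐S stM , S∉L))))
    where
    M≐S : M ≐ heads Q ∩ M
    M≐S = stable≐heads∩ stM

fresh : AtomSet → Atom
fresh A = suc (max 0 A)

fresh-∉ : ∀ A → fresh A ∉ A
fresh-∉ A fresh∈A = <-irrefl refl (All.lookup (xs≤max 0 A) fresh∈A)

blockedBy : Atom → Clause → Clause
blockedBy x c = head c ⇐ pos c ∣ (x ∷ neg c)

withFreshModel : Program → Program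
withFreshModel R = (fresh (heads R) ⇐ [] ∣ heads R) ∷ map (blockedBy (fresh (heads R))) R

length-withFreshModel : ∀ R → length (withFreshModel R) ≡ suc (length R)
length-withFreshModel R = cong suc (length-map _ R)

stable-fresh : ∀ R → StableModel (withFreshModel R) [ fresh (heads R) ]
stable-fresh R = (model ∷ All.map⁺ (All.tabulate blocked)) , least
  where
  x = fresh (heads R)
  model : SatisfiesReduct [ x ] [ x ] (x ⇐ [] ∣ heads R)
  model _ _ = here refl
  blocked : ∀ {c} → c ∈ R → SatisfiesReduct [ x ] [ x ] (blockedBy x c)
  blocked _ surv _ = ⊥-elim (All.head surv (here refl))
  headsSurvive : Survives [ x ] (x ⇐ [] ∣ heads R)
  headsSurvive = All.tabulate λ { h∈heads (here refl) → fresh-∉ (heads R) h∈heads }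
  least : ∀ N → ModelOfReduct (withFreshModel R) [ x ] N → [ x ] ⊆ N
  least N (sat ∷ _) (here refl) = sat headsSurvive (λ ())

stable-withFreshModel : ∀ {R M} → StableModel R M → M ≢ [] → StableModel (withFreshModel R) M
stable-withFreshModel {M = []} _ M≢[] = ⊥-elim (M≢[] refl)
stable-withFreshModel {R} {M@(_ ∷ _)} stM@(model , least) _ =
  (blocked ∷ All.map⁺ (All.map (λ sat surv → sat (All.tail surv)) model)) , least′
  where
  x = fresh (heads R)
  blocked : SatisfiesReduct M M (x ⇐ [] ∣ heads R)
  blocked surv _ = ⊥-elim (All.lookup surv (stable⊆heads stM (here refl)) (here refl))
  x∉M : x ∉ M
  x∉M = fresh-∉ (heads R) ∘ stable⊆heads stM
  least′ : ∀ N → ModelOfReduct (withFreshModel R) M N → M ⊆ N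
  least′ N (_ ∷ modelN) = least N (All.map (λ sat surv → sat (x∉M ∷ surv)) (All.map⁻ modelN))

stable-withFreshModel-distinct : ∀ {R L} → All (StableModel R) L → Distinct L →
  Distinct ([ fresh (heads R) ] ∷ L)
stable-withFreshModel-distinct {R} stL L! =
  All.map (λ stM x≐M → fresh-∉ (heads R) (stable⊆heads stM (proj₁ x≐M (here refl)))) stL ∷ L!

fewerClauses⇒fewerModels : ∀ {n P k R L} → Extremal n P k → length R < n →
  All (StableModel R) L → All (_≢ []) L → Distinct L → length L < k
fewerClauses⇒fewerModels {n} {R = R} {L} ext R<n stL nonempty L!
  with numStableModels-≥ (withFreshModel R) ([ fresh (heads R) ] ∷ L)
         (stable-fresh R ∷ All.zipWith (λ (stM , M≢[]) → stable-withFreshModel stM M≢[])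
                                        (stL , nonempty))
         (stable-withFreshModel-distinct stL L!)
... | k′ , count , L<k′ =
  <-≤-trans L<k′
    (ext (withFreshModel R) k′ (subst (_≤ n) (sym (length-withFreshModel R)) R<n) count)

stable-fact : ∀ a → StableModel [ a ⇐ [] ∣ [] ] [ a ]
stable-fact a = ((λ _ _ → here refl) ∷ []) , λ { N (sat ∷ []) (here refl) → sat [] (λ ()) }

-- withFreshModel [ 0 ← ] is the even loop  1 ← not 0,  0 ← not 1.
extremal⇒2≤k : ∀ {n P k} → 2 ≤ n → Extremal n P k → 2 ≤ k
extremal⇒2≤k {P = P} 2≤n ext = fewerClauses⇒fewerModels {P = P} {R = [ 0 ⇐ [] ∣ [] ]}
  ext 2≤n (stable-fact 0 ∷ []) ((λ ()) ∷ []) ([] ∷ [])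

stable-[]-unique : ∀ {R M} → StableModel R [] → StableModel R M → M ≐ []
stable-[]-unique (model[] , _) (_ , least) = least [] (model-resp (λ ()) ≐-refl model[]) , λ ()

length≤1 : ∀ {A L} → Distinct L → All (_≐ A) L → length L ≤ 1
length≤1 [] [] = z≤n
length≤1 (_ ∷ []) (_ ∷ []) = s≤s z≤n
length≤1 ((B≉C ∷ _) ∷ _) (B≐A ∷ C≐A ∷ _) = ⊥-elim (B≉C (≐-trans B≐A (≐-sym C≐A)))

distinct-stable⇒nonempty : ∀ {R L} → 2 ≤ length L → All (StableModel R) L → Distinct L →
  All (_≢ []) L
distinct-stable⇒nonempty 2≤L stL L! = All.tabulate λ { M∈L refl →
  <⇒≱ 2≤L (length≤1 L! (All.map (stable-[]-unique (All.lookup stL M∈L)) stL)) }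

extremal-strict : ∀ {n P k R L} → 2 ≤ n → Extremal n P k → length R < n →
  All (StableModel R) L → Distinct L → length L < k
extremal-strict {P = P} {L = L} 2≤n ext R<n stL L! with length L <? 2
... | yes L<2 = <-≤-trans L<2 (extremal⇒2≤k {P = P} 2≤n ext)
... | no L≮2 =
  fewerClauses⇒fewerModels {P = P} ext R<n stL (distinct-stable⇒nonempty (≮⇒≥ L≮2) stL L!) L!

Harmless : AtomSet → Clause → Set
Harmless M c = ∀ {S} → S ⊆ M → SatisfiesReduct M S c

harmless-if-pos⊈ : ∀ {a M c} → a ∈ pos c → a ∉ M → Harmless M c
harmless-if-pos⊈ a∈pos a∉M S⊆M _ pos⊆S = ⊥-elim (a∉M (S⊆M (pos⊆S a∈pos)))

redundant⇒harmless : ∀ {M c} → RedundantClause c → SatisfiesReduct M M c → Harmless M c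
redundant⇒harmless (inj₁ head∈pos) _ _ _ pos⊆S = pos⊆S head∈pos
redundant⇒harmless (inj₂ (inj₁ head∈neg)) sat S⊆M surv pos⊆S =
  ⊥-elim (All.lookup surv head∈neg (sat surv (λ q → S⊆M (pos⊆S q))))
redundant⇒harmless (inj₂ (inj₂ (q , q∈pos , q∈neg))) _ S⊆M surv pos⊆S =
  ⊥-elim (All.lookup surv q∈neg (S⊆M (pos⊆S q∈pos)))

All-removeAt⁺ : ∀ {A : Set} {Q : A → Set} xs i → All Q xs → All Q (removeAt xs i)
All-removeAt⁺ (_ ∷ _) zero (_ ∷ qxs) = qxs
All-removeAt⁺ (_ ∷ xs) (suc i) (qx ∷ qxs) = qx ∷ All-removeAt⁺ xs i qxs

All-removeAt⁻ : ∀ {A : Set} {Q : A → Set} xs i → Q (lookup xs i) → All Q (removeAt xs i) → All Q xs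
All-removeAt⁻ (_ ∷ _) zero qx qxs = qx ∷ qxs
All-removeAt⁻ (_ ∷ xs) (suc i) qxᵢ (qx ∷ qxs) = qx ∷ All-removeAt⁻ xs i qxᵢ qxs

stable-removeAt : ∀ P i {M} → StableModel P M → Harmless M (lookup P i) →
  StableModel (removeAt P i) M
stable-removeAt P i {M} (model , least) harmless = model′ , λ N modelN →
  ∩-⊆ʳ {M} ∘ least (M ∩ N) (All-removeAt⁻ P i (harmless (∩-⊆ˡ {M} {N})) (model-∩ model′ modelN))
  where
  model′ = All-removeAt⁺ P i model

Settled : Atom → Clause → Set
Settled a c = head c ≡ a ⊎ a ∈ neg c

settled? : ∀ a → Decidable (Settled a)
settled? a c = head c ≟ a ⊎-dec a ∈? neg c

dropFromBody : Atom → Clause → Clause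
dropFromBody a c = head c ⇐ pos c ∖ a ∣ neg c

assumeTrue : Atom → Program → Program
assumeTrue a P = map (dropFromBody a) (filter (¬? ∘ settled? a) P)

length-assumeTrue : ∀ {a P} → Any (Settled a) P → length (assumeTrue a P) < length P
length-assumeTrue {a} {P} settled =
  subst (_< length P) (sym (length-map (dropFromBody a) (filter (¬? ∘ settled? a) P)))
    (filter-notAll (¬? ∘ settled? a) P (Any.map (λ s ¬s → ¬s s) settled))

survives-⊆∖ : ∀ {a c M₁ M₂} → a ∉ neg c → M₁ ∖ a ⊆ M₂ → Survives M₂ c → Survives M₁ c
survives-⊆∖ a∉neg M₁∖a⊆M₂ surv = All.tabulate λ y∈neg y∈M₁ →
  All.lookup surv y∈neg (M₁∖a⊆M₂ (∈-∖⁺ y∈M₁ λ { refl → a∉neg y∈neg }))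

stable-assumeTrue : ∀ {a P M} → StableModel P M → (∀ {c} → c ∈ P → InBody a c → a ∈ M) →
  StableModel (assumeTrue a P) (M ∖ a)
stable-assumeTrue {a} {P} {M} (model , least) needed = All.map⁺ (All.tabulate model′) , least′
  where
  model′ : ∀ {c} → c ∈ filter (¬? ∘ settled? a) P →
    SatisfiesReduct (M ∖ a) (M ∖ a) (dropFromBody a c)
  model′ {c} c∈ surv pos⊆ with c∈P , unsettled ← ∈-filter⁻ (¬? ∘ settled? a) c∈ =
    ∈-∖⁺ (All.lookup model c∈P (survives-⊆∖ {c = c} (unsettled ∘ inj₂) id surv)
                              (∖-cancel (needed c∈P ∘ inj₁) pos⊆))
         (unsettled ∘ inj₁)
  least′ : ∀ N → ModelOfReduct (assumeTrue a P) (M ∖ a) N → M ∖ a ⊆ N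
  least′ N modelN = ⊆∷⇒∖⊆ (least (a ∷ N)
    (All.filter⁻ (settled? a) (All.tabulate settledSat) (All.tabulate keptSat)))
    where
    settledSat : ∀ {c} → c ∈ filter (settled? a) P → SatisfiesReduct M (a ∷ N) c
    settledSat c∈ surv _ with ∈-filter⁻ (settled? a) c∈
    ... | _ , inj₁ refl = here refl
    ... | c∈P , inj₂ a∈neg = ⊥-elim (All.lookup surv a∈neg (needed c∈P (inj₂ a∈neg)))
    keptSat : ∀ {c} → c ∈ filter (¬? ∘ settled? a) P → SatisfiesReduct M (a ∷ N) c
    keptSat {c} c∈ surv pos⊆ =
      there (All.lookup (All.map⁻ modelN) c∈ (survives-anti {c = c} ∖-⊆ surv) (⊆∷⇒∖⊆ pos⊆))

∖-injective : ∀ {a A B} → a ∈ A → a ∈ B → A ∖ a ≐ B ∖ a → A ≐ B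
∖-injective a∈A a∈B (A∖a⊆B∖a , B∖a⊆A∖a) =
  ∖-cancel (λ _ → a∈B) A∖a⊆B∖a , ∖-cancel (λ _ → a∈A) B∖a⊆A∖a

stable-⊆-if-survives : ∀ {P M₁ M₂} → (∀ {c} → c ∈ P → Survives M₂ c → Survives M₁ c) →
  StableModel P M₁ → StableModel P M₂ → M₂ ⊆ M₁
stable-⊆-if-survives survives (model₁ , _) (_ , least₂) =
  least₂ _ (All.tabulate λ c∈P surv → All.lookup model₁ c∈P (survives c∈P surv))

-- An atom that is never negated does not influence the reduct.
∉neg⇒stable-∖-injective : ∀ {a P M₁ M₂} → (∀ {c} → c ∈ P → a ∉ neg c) →
  StableModel P M₁ → StableModel P M₂ → M₁ ∖ a ≐ M₂ ∖ a → M₁ ≐ M₂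
∉neg⇒stable-∖-injective {a} {P} a∉neg st₁ st₂ (M₁∖a⊆M₂∖a , M₂∖a⊆M₁∖a) =
    stable-⊆-if-survives (survives M₂∖a⊆M₁∖a) st₂ st₁
  , stable-⊆-if-survives (survives M₁∖a⊆M₂∖a) st₁ st₂
  where
  survives : ∀ {A B} → A ∖ a ⊆ B ∖ a → ∀ {c} → c ∈ P → Survives B c → Survives A c
  survives {B = B} A∖a⊆B∖a {c} c∈P =
    survives-⊆∖ {c = c} (a∉neg c∈P) (λ q → ∖-⊆ {A = B} (A∖a⊆B∖a q))

distinct-map : ∀ {Pr : AtomSet → Set} {f : AtomSet → AtomSet} {L} →
  (∀ {A B} → Pr A → Pr B → f A ≐ f B → A ≐ B) → All Pr L → Distinct L → Distinct (map f L)
distinct-map injective [] [] = []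
distinct-map injective (prA ∷ prL) (A≉L ∷ L!) =
    All.map⁺ (All.zipWith (λ (prB , A≉B) → A≉B ∘ injective prA prB) (prL , A≉L))
  ∷ distinct-map injective prL L!

inBody? : ∀ a c → Dec (InBody a c)
inBody? a c = a ∈? pos c ⊎-dec a ∈? neg c

elsewhere-or-absent : ∀ P i {a} → ¬ InBody a (lookup P i) →
  (∃ λ j → j ≢ i × InBody a (lookup P j)) ⊎ (∀ {c} → c ∈ P → ¬ InBody a c)
elsewhere-or-absent P i {a} a∉i with Fin.any? (λ j → ¬? (j Fin.≟ i) ×-dec inBody? a (lookup P j))
... | yes found = inj₁ found
... | no none = inj₂ λ c∈P →
  subst (¬_ ∘ InBody a) (sym (Any.lookup-index c∈P)) (absentAt (Any.index c∈P))
  where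
  absentAt : ∀ j → ¬ InBody a (lookup P j)
  absentAt j with j Fin.≟ i
  ... | yes refl = a∉i
  ... | no j≢i = none ∘ (j ,_) ∘ (j≢i ,_)

stable⇒isHead : ∀ {P M a} → StableModel P M → a ∈ M → IsHeadIn a P
stable⇒isHead stM a∈M = Any.map sym (Any.map⁻ (stable⊆heads stM a∈M))

fact∈stable : ∀ {P M c} → c ∈ P → pos c ≡ [] → neg c ≡ [] → StableModel P M → head c ∈ M
fact∈stable {c = _ ⇐ .[] ∣ .[]} c∈P refl refl (model , _) = All.lookup model c∈P [] (λ ())

module Extremality {P : Program} {L : List AtomSet} (2≤P : 2 ≤ length P)
  (ext : Extremal (length P) P (length L)) (stL : All (StableModel P) L) (L! : Distinct L) where

  no-smaller-rival : ∀ {R} L′ → length R < length P → length L′ ≡ length L →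
    All (StableModel R) L′ → Distinct L′ → ⊥
  no-smaller-rival L′ R<P L′≡L stL′ L′! =
    <-irrefl L′≡L (extremal-strict {P = P} 2≤P ext R<P stL′ L′!)

  not-harmless : ∀ i → ¬ (∀ {M} → StableModel P M → Harmless M (lookup P i))
  not-harmless i harmless = no-smaller-rival L (≤-reflexive (sym (length-removeAt′ P i))) refl
    (All.map (λ stM → stable-removeAt P i stM (harmless stM)) stL) L!

  not-assumable : ∀ {a} → IsHeadIn a P →
    (∀ {M} → StableModel P M → ∀ {c} → c ∈ P → InBody a c → a ∈ M) →
    ¬ (∀ {M₁ M₂} → StableModel P M₁ → StableModel P M₂ → M₁ ∖ a ≐ M₂ ∖ a → M₁ ≐ M₂)
  not-assumable {a} isHead needed injective =
    no-smaller-rival (map (_∖ a) L) (length-assumeTrue (Any.map inj₁ isHead)) (length-map (_∖ a) L)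
      (All.map⁺ (All.map (λ stM → stable-assumeTrue stM (needed stM)) stL))
      (distinct-map injective stL L!)

lemma11 : (n : ℕ) → 2 ≤ n → (P : Program) → length P ≡ n → DistinctClauses P →
    (k : ℕ) → NumStableModels P k → Extremal n P k →
    (∀ (i : Fin (length P)) (a : Atom) → a ∈ pos (lookup P i) → ¬ RedundantAtom P a)
    × (∀ (i : Fin (length P)) → ¬ RedundantClause (lookup P i))
    × (∀ (i : Fin (length P)) → ¬ ((pos (lookup P i) ≡ []) × (neg (lookup P i) ≡ [])))
    × (∀ (i : Fin (length P)) → ∃ λ (j : Fin (length P)) → (j ≢ i) × InBody (head (lookup P i)) (lookup P j))
lemma11 .(length P) 2≤P P refl _ .(length L) (L , refl , stL , L! , _) ext =
  noRedundantAtomInBody , noRedundantClause , noFact , headInOtherBody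
  where
  open Extremality 2≤P ext stL L!
  isHead : ∀ i → IsHeadIn (head (lookup P i)) P
  isHead i = Any.map (λ { refl → refl }) (∈-lookup i)
  noRedundantAtomInBody : ∀ i a → a ∈ pos (lookup P i) → ¬ RedundantAtom P a
  noRedundantAtomInBody i a a∈pos (_ , notHead) =
    not-harmless i λ stM → harmless-if-pos⊈ a∈pos (notHead ∘ stable⇒isHead stM)
  noRedundantClause : ∀ i → ¬ RedundantClause (lookup P i)
  noRedundantClause i red =
    not-harmless i λ (model , _) → redundant⇒harmless red (All.lookup model (∈-lookup i))
  noFact : ∀ i → ¬ ((pos (lookup P i) ≡ []) × (neg (lookup P i) ≡ []))
  noFact i (pos≡[] , neg≡[]) =
    not-assumable (isHead i) (λ stM _ _ → fact∈ stM) λ st₁ st₂ → ∖-injective (fact∈ st₁) (fact∈ st₂)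
    where
    fact∈ : ∀ {M} → StableModel P M → head (lookup P i) ∈ M
    fact∈ = fact∈stable (∈-lookup i) pos≡[] neg≡[]
  headInOtherBody : ∀ i → ∃ λ j → j ≢ i × InBody (head (lookup P i)) (lookup P j)
  headInOtherBody i with elsewhere-or-absent P i (noRedundantClause i ∘ Sum.map₂ inj₁)
  ... | inj₁ found = found
  ... | inj₂ absent = ⊥-elim (not-assumable (isHead i) (λ _ c∈P a∈c → ⊥-elim (absent c∈P a∈c))
                                            (∉neg⇒stable-∖-injective (λ c∈P → absent c∈P ∘ inj₂)))
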